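{- Let $n\ge 1$, $1\le m\le n$ and $0\le t\le m-1$ be integers and consider the flag-shaped minimum blocker $B_n(m,t)$ of all $n\times n$ $123$-avoiding permutation matrices. Then for every position $(i,j)$ with $n-t+1\le i\le n$ and $m+1\le j\le n$ (the $t\times(n-m)$ block of adjacent positions containing $(n,n)$), there is no $n\times n$ $123$-avoiding permutation matrix $P$ with a $1$ in position $(i,j)$ that intersects $B_n(m,t)$ exactly once (i.e. has exactly one $1$ in a position of $B_n(m,t)$).
   Context: A permutation matrix $P$ contains a $123$-pattern if $I_3$ is a submatrix of $P$; otherwise $P$ is $123$-avoiding. A set of positions is a blocker if every $n\times n$ $123$-avoiding permutation matrix has a $1$ in one of its positions, and it is minimum if removing any element makes it no longer a blocker. For integers $1\le m\le n$, $0\le t\le m-1$, the flag-shaped blocker $B_n(m,t)$ is the union of $\{(i,m): 1\le i\le n-t\}$ and $\{(i,j): 1\le i\le n-m+1,\ m-t\le j\le m-1\}$, positions written as (row, column); it is a minimum blocker. -}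

module Defs where

open import Data.Nat using (ℕ; suc; _+_; _∸_; _≤_; _<_)
open import Data.Fin using (Fin; toℕ)
open import Data.Fin.Permutation using (Permutation′; _⟨$⟩ʳ_)
open import Data.Product using (_×_; ∃; ∃-syntax)
open import Data.Sum using (_⊎_)
open import Relation.Binary.PropositionalEquality using (_≡_)
open import Relation.Nullary using (¬_)

-- An n×n permutation matrix is represented by a permutation σ of Fin n:
-- the matrix has its 1 in row r at column σ r (0-based indices).
-- Positions in the paper are 1-based: row (toℕ r + 1), column (toℕ (σ r) + 1).

row : ∀ {n} → Fin n → ℕ
row r = suc (toℕ r)

col : ∀ {n} → Permutation′ n → Fin n → ℕ
col σ r = suc (toℕ (σ ⟨$⟩ʳ r))

Contains123 : ∀ {n} → Permutation′ n → Set
Contains123 {n} σ = ∃[ a ] ∃[ b ] ∃[ c ]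
  (toℕ a < toℕ b × toℕ b < toℕ c ×
   toℕ (σ ⟨$⟩ʳ a) < toℕ (σ ⟨$⟩ʳ b) × toℕ (σ ⟨$⟩ʳ b) < toℕ (σ ⟨$⟩ʳ c))

Avoids123 : ∀ {n} → Permutation′ n → Set
Avoids123 σ = ¬ Contains123 σ

InB : (n m t i j : ℕ) → Set
InB n m t i j =
  (1 ≤ i × i ≤ n ∸ t × j ≡ m)
  ⊎ (1 ≤ i × i ≤ n ∸ m + 1 × m ∸ t ≤ j × j ≤ m ∸ 1)

HitsB : ∀ {n} → (m t : ℕ) → Permutation′ n → Fin n → Set
HitsB {n} m t σ r = InB n m t (row r) (col σ r)

-- σ intersects B_n(m,t) exactly once: exactly one of its 1's lies in B_n(m,t)
-- (each 1 is determined by its row).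
IntersectsExactlyOnce : ∀ {n} → (m t : ℕ) → Permutation′ n → Set
IntersectsExactlyOnce m t σ =
  ∃[ r ] (HitsB m t σ r × (∀ r′ → HitsB m t σ r′ → r′ ≡ r))

{-# OPTIONS --safe #-}
module Submission where

-- Read the permutation column by column: T c is the row of the 1 in column c, and the
-- given 1 sits at (i₀ , j₀) with j₀ ≥ m and i₀ ≥ n − t (0-based).  Columns before j₀
-- with their 1 above row i₀ have decreasing rows, otherwise they would form a 123 with
-- (i₀ , j₀).  The t + 1 columns m − t − 1 , … , m − 1 cannot all but one have their 1
-- below row i₀, as only n − 1 − i₀ < t rows are available; so the two rightmost
-- columns c′ < c before m with their 1 above row i₀ lie in this window.  Every other
-- column before m, and j₀ itself, has its 1 below row T c′, which leaves room for these
-- m − 1 ones only if T c′ ≤ n − m; and T c ≤ T c′.  In 1-based terms both 1's lie in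
-- rows 1 … n − m + 1 and columns m − t … m, a box contained in B_n(m,t).

open import Defs
open import Data.Nat using (ℕ; suc; _+_; _∸_; _≤_; _<_; _≟_; _<?_; _≤?_; z≤n; s≤s; s≤s⁻¹)
open import Data.Nat.Properties
open import Data.Fin using (Fin; toℕ; fromℕ<)
open import Data.Fin.Properties using (toℕ<n; toℕ-injective; toℕ-fromℕ<; fromℕ<-toℕ; injective⇒≤)
open import Data.Fin.Permutation using (Permutation′; _⟨$⟩ʳ_; _⟨$⟩ˡ_; inverseˡ; inverseʳ)
open import Data.Product using (_×_; _,_; ∃-syntax; proj₁; proj₂)
open import Data.Sum using (_⊎_; inj₁; inj₂)
open import Data.Empty using (⊥; ⊥-elim)
open import Function using (_∘_)
open import Relation.Binary.PropositionalEquality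
open import Relation.Binary.Definitions using (tri<; tri≈; tri>)
open import Relation.Nullary using (¬_; yes; no; contradiction)
open import Relation.Nullary.Decidable using (_×-dec_)
open import Relation.Unary using (Decidable)

InjectiveBelow : ℕ → (ℕ → ℕ) → Set
InjectiveBelow a g = ∀ {x y} → x < a → y < a → g x ≡ g y → x ≡ y

injectiveBelow⇒≤ : ∀ {a l b} (g : ℕ → ℕ) → l ≤ b →
                   (∀ {x} → x < a → l ≤ g x × g x < b) → InjectiveBelow a g → a + l ≤ b
injectiveBelow⇒≤ {a} {l} {b} g l≤b bounds g-injective =
  m≤o∸n⇒m+n≤o a l≤b (injective⇒≤ f-injective)
  where
  f : Fin a → Fin (b ∸ l)
  f x = fromℕ< (∸-monoˡ-< (proj₂ (bounds (toℕ<n x))) (proj₁ (bounds (toℕ<n x))))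

  f-injective : ∀ {x y} → f x ≡ f y → x ≡ y
  f-injective {x} {y} fx≡fy = toℕ-injective (g-injective (toℕ<n x) (toℕ<n y)
    (∸-cancelʳ-≡ (proj₁ (bounds (toℕ<n x))) (proj₁ (bounds (toℕ<n y)))
      (trans (sym (toℕ-fromℕ< _)) (trans (cong toℕ fx≡fy) (toℕ-fromℕ< _)))))

greatest-below : ∀ {P : ℕ → Set} → Decidable P → ∀ b →
  (∃[ c ] (c < b × P c × (∀ {d} → c < d → d < b → ¬ P d))) ⊎ (∀ {d} → d < b → ¬ P d)
greatest-below P? 0 = inj₂ λ ()
greatest-below {P} P? (suc b) with P? b
... | yes Pb = inj₁ (b , ≤-refl , Pb , λ b<d d<1+b → contradiction (s≤s⁻¹ d<1+b) (<⇒≱ b<d))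
... | no ¬Pb with greatest-below P? b
...   | inj₁ (c , c<b , Pc , none-above) = inj₁ (c , m<n⇒m<1+n c<b , Pc , none-above′)
  where
  none-above′ : ∀ {d} → c < d → d < suc b → ¬ P d
  none-above′ c<d d<1+b with m<1+n⇒m<n∨m≡n d<1+b
  ... | inj₁ d<b  = none-above c<d d<b
  ... | inj₂ refl = ¬Pb
...   | inj₂ none = inj₂ none′
  where
  none′ : ∀ {d} → d < suc b → ¬ P d
  none′ d<1+b with m<1+n⇒m<n∨m≡n d<1+b
  ... | inj₁ d<b  = none d<b
  ... | inj₂ refl = ¬Pb

inB-box : ∀ {n m t i j} → t < m → i + m ≤ n → m ∸ suc t ≤ j → j < m → InB n m t (suc i) (suc j)
inB-box {n} {m} {t} {i} {j} t<m i+m≤n lo≤j j<m with m<1+n⇒m<n∨m≡n (s≤s j<m)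
... | inj₁ 1+j<m = inj₂ (s≤s z≤n , 1+i≤n∸m+1 , m∸t≤1+j , <⇒≤pred 1+j<m)
  where
  1+i≤n∸m+1 : suc i ≤ n ∸ m + 1
  1+i≤n∸m+1 = subst (_≤ n ∸ m + 1) (+-comm i 1) (+-monoˡ-≤ 1 (m+n≤o⇒m≤o∸n i i+m≤n))

  m∸t≤1+j : m ∸ t ≤ suc j
  m∸t≤1+j = subst (_≤ suc j) (sym (+-∸-assoc 1 t<m)) (s≤s lo≤j)
... | inj₂ 1+j≡m = inj₁ (s≤s z≤n , m+n≤o⇒m≤o∸n (suc i) 1+i+t≤n , 1+j≡m)
  where
  1+i+t≤n : suc i + t ≤ n
  1+i+t≤n = ≤-trans (≤-reflexive (sym (+-suc i t))) (≤-trans (+-monoʳ-≤ i t<m) i+m≤n)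

module LeftOf {n : ℕ} (T : ℕ → ℕ)
  (T-< : ∀ {c} → c < n → T c < n)
  (T-injective : InjectiveBelow n T)
  (T-avoids123 : ∀ {x y z} → x < y → y < z → z < n → T x < T y → ¬ T y < T z)
  {i₀ j₀ m : ℕ} (T-j₀ : T j₀ ≡ i₀) (j₀<n : j₀ < n) (m≤j₀ : m ≤ j₀) where

  <m⇒<j₀ : ∀ {d} → d < m → d < j₀
  <m⇒<j₀ d<m = <-≤-trans d<m m≤j₀

  <m⇒<n : ∀ {d} → d < m → d < n
  <m⇒<n d<m = <-trans (<m⇒<j₀ d<m) j₀<n

  i₀<n : i₀ < n
  i₀<n = subst (_< n) T-j₀ (T-< j₀<n)

  no-ascent-above-i₀ : ∀ {d e} → d < e → e < m → T e < i₀ → ¬ T d < T e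
  no-ascent-above-i₀ d<e e<m Te<i₀ Td<Te =
    T-avoids123 d<e (<m⇒<j₀ e<m) j₀<n Td<Te (subst (T _ <_) (sym T-j₀) Te<i₀)

  redirect : ℕ → ℕ → ℕ
  redirect k d with d ≟ k
  ... | yes _ = j₀
  ... | no _  = d

  redirect-< : ∀ k {d} → d < m → redirect k d < n
  redirect-< k {d} d<m with d ≟ k
  ... | yes _ = j₀<n
  ... | no _  = <m⇒<n d<m

  redirect-injective : ∀ k {d e} → d < m → e < m → redirect k d ≡ redirect k e → d ≡ e
  redirect-injective k {d} {e} d<m e<m eq with d ≟ k | e ≟ k
  ... | yes d≡k | yes e≡k = trans d≡k (sym e≡k)
  ... | yes _   | no _    = contradiction (sym eq) (<⇒≢ (<m⇒<j₀ e<m))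
  ... | no _    | yes _   = contradiction eq (<⇒≢ (<m⇒<j₀ d<m))
  ... | no _    | no _    = eq

  T-redirect-≥ : ∀ {l} k {d} → l ≤ i₀ → (d ≢ k → l ≤ T d) → l ≤ T (redirect k d)
  T-redirect-≥ k {d} l≤i₀ low with d ≟ k
  ... | yes _   = subst (_ ≤_) (sym T-j₀) l≤i₀
  ... | no d≢k = low d≢k

  -- Column k of the window is swapped for column j₀, whose 1 is in row i₀.
  window-count : ∀ {lo a l} k → lo + a ≤ m → l ≤ i₀ →
                 (∀ {d} → lo ≤ d → d < lo + a → d ≢ k → l ≤ T d) → a + l ≤ n
  window-count {lo} {a} {l} k window l≤i₀ low =
    injectiveBelow⇒≤ (T ∘ column) (≤-trans l≤i₀ (<⇒≤ i₀<n)) bounds column-injective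
    where
    column : ℕ → ℕ
    column x = redirect k (lo + x)

    in-window : ∀ {x} → x < a → lo + x < m
    in-window x<a = <-≤-trans (+-monoʳ-< lo x<a) window

    bounds : ∀ {x} → x < a → l ≤ T (column x) × T (column x) < n
    bounds {x} x<a = T-redirect-≥ k l≤i₀ (low (m≤m+n lo x) (+-monoʳ-< lo x<a))
                   , T-< (redirect-< k (in-window x<a))

    column-injective : InjectiveBelow a (T ∘ column)
    column-injective x<a y<a eq = +-cancelˡ-≡ lo _ _
      (redirect-injective k (in-window x<a) (in-window y<a)
        (T-injective (redirect-< k (in-window x<a)) (redirect-< k (in-window y<a)) eq))

  module Window (t : ℕ) (t<m : t < m) (n≤t+i₀ : n ≤ t + i₀) where

    lo : ℕ
    lo = m ∸ suc t

    InBox : ℕ → Set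
    InBox d = lo ≤ d × d < m × T d + m ≤ n

    Above : ℕ → Set
    Above d = lo ≤ d × T d < i₀

    above? : Decidable Above
    above? d = lo ≤? d ×-dec T d <? i₀

    not-all-but-one-below : ∀ k → ¬ (∀ {d} → lo ≤ d → d < m → d ≢ k → ¬ T d < i₀)
    not-all-but-one-below k below = <-irrefl refl (≤-trans count n≤t+i₀)
      where
      count : suc t + i₀ ≤ n
      count = window-count k (≤-reflexive (m∸n+n≡m t<m)) ≤-refl λ lo≤d d<lo+1+t d≢k →
        ≮⇒≥ (below lo≤d (<-≤-trans d<lo+1+t (≤-reflexive (m∸n+n≡m t<m))) d≢k)

    top-two-in-box : ∀ {c c′} → c′ < c → c < m → T c < i₀ → Above c′ →
                     (∀ {d} → c′ < d → d < m → d ≢ c → ¬ T d < i₀) → InBox c × InBox c′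
    top-two-in-box {c} {c′} c′<c c<m Tc<i₀ (lo≤c′ , Tc′<i₀) only-c-above =
        (≤-trans lo≤c′ (<⇒≤ c′<c) , c<m , ≤-trans (+-monoˡ-≤ m Tc≤Tc′) Tc′+m≤n)
      , (lo≤c′ , <-trans c′<c c<m , Tc′+m≤n)
      where
      Tc≤Tc′ : T c ≤ T c′
      Tc≤Tc′ = ≮⇒≥ (no-ascent-above-i₀ c′<c c<m Tc<i₀)

      below-T-c′ : ∀ {d} → 0 ≤ d → d < 0 + m → d ≢ c → T c′ ≤ T d
      below-T-c′ {d} _ d<m d≢c with <-cmp d c′
      ... | tri< d<c′ _ _ = ≮⇒≥ (no-ascent-above-i₀ d<c′ (<-trans c′<c c<m) Tc′<i₀)
      ... | tri≈ _ refl _ = ≤-refl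
      ... | tri> _ _ c′<d = <⇒≤ (<-≤-trans Tc′<i₀ (≮⇒≥ (only-c-above c′<d d<m d≢c)))

      Tc′+m≤n : T c′ + m ≤ n
      Tc′+m≤n = subst (_≤ n) (+-comm m (T c′)) (window-count c ≤-refl (<⇒≤ Tc′<i₀) below-T-c′)

    two-columns-in-box : ∃[ c ] ∃[ c′ ] (c′ < c × InBox c × InBox c′)
    two-columns-in-box with greatest-below above? m
    ... | inj₂ none =
      ⊥-elim (not-all-but-one-below lo λ lo≤d d<m _ Td<i₀ → none d<m (lo≤d , Td<i₀))
    ... | inj₁ (c , c<m , (_ , Tc<i₀) , none-right-of-c) with greatest-below above? c
    ...   | inj₂ none = ⊥-elim (not-all-but-one-below c only-c-above)
      where
      only-c-above : ∀ {d} → lo ≤ d → d < m → d ≢ c → ¬ T d < i₀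
      only-c-above {d} lo≤d d<m d≢c Td<i₀ with <-cmp d c
      ... | tri< d<c _ _ = none d<c (lo≤d , Td<i₀)
      ... | tri≈ _ d≡c _ = d≢c d≡c
      ... | tri> _ _ c<d = none-right-of-c c<d d<m (lo≤d , Td<i₀)
    ...   | inj₁ (c′ , c′<c , above-c′ , none-between) =
      c , c′ , c′<c , top-two-in-box c′<c c<m Tc<i₀ above-c′ only-c-above
      where
      lo≤ : ∀ {d} → c′ < d → lo ≤ d
      lo≤ c′<d = ≤-trans (proj₁ above-c′) (<⇒≤ c′<d)

      only-c-above : ∀ {d} → c′ < d → d < m → d ≢ c → ¬ T d < i₀
      only-c-above {d} c′<d d<m d≢c Td<i₀ with <-cmp d c
      ... | tri< d<c _ _ = none-between c′<d d<c (lo≤ c′<d , Td<i₀)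
      ... | tri≈ _ d≡c _ = d≢c d≡c
      ... | tri> _ _ c<d = none-right-of-c c<d d<m (lo≤ c′<d , Td<i₀)

module InverseOf {n : ℕ} (σ : Permutation′ n) where

  rowOf : ∀ {c} → c < n → Fin n
  rowOf c<n = σ ⟨$⟩ˡ fromℕ< c<n

  -- Junk value n for c ≥ n; T is only consulted on columns c < n.
  T : ℕ → ℕ
  T c with c <? n
  ... | yes c<n = toℕ (rowOf c<n)
  ... | no _    = n

  T-rowOf : ∀ {c} (c<n : c < n) → T c ≡ toℕ (rowOf c<n)
  T-rowOf {c} c<n with c <? n
  ... | yes _    = refl
  ... | no c≮n  = contradiction c<n c≮n

  column-rowOf : ∀ {c} (c<n : c < n) → toℕ (σ ⟨$⟩ʳ rowOf c<n) ≡ c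
  column-rowOf c<n = trans (cong toℕ (inverseʳ σ)) (toℕ-fromℕ< c<n)

  rowOf-injective : ∀ {c d} (c<n : c < n) (d<n : d < n) → rowOf c<n ≡ rowOf d<n → c ≡ d
  rowOf-injective c<n d<n eq =
    trans (sym (column-rowOf c<n)) (trans (cong (toℕ ∘ (σ ⟨$⟩ʳ_)) eq) (column-rowOf d<n))

  T-< : ∀ {c} → c < n → T c < n
  T-< c<n = subst (_< n) (sym (T-rowOf c<n)) (toℕ<n _)

  T-injective : InjectiveBelow n T
  T-injective c<n d<n eq =
    rowOf-injective c<n d<n (toℕ-injective (trans (sym (T-rowOf c<n)) (trans eq (T-rowOf d<n))))

  T-avoids123 : Avoids123 σ → ∀ {x y z} → x < y → y < z → z < n → T x < T y → ¬ T y < T z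
  T-avoids123 avoids x<y y<z z<n Tx<Ty Ty<Tz = avoids
    ( rowOf x<n , rowOf y<n , rowOf z<n
    , subst₂ _<_ (T-rowOf x<n) (T-rowOf y<n) Tx<Ty
    , subst₂ _<_ (T-rowOf y<n) (T-rowOf z<n) Ty<Tz
    , subst₂ _<_ (sym (column-rowOf x<n)) (sym (column-rowOf y<n)) x<y
    , subst₂ _<_ (sym (column-rowOf y<n)) (sym (column-rowOf z<n)) y<z )
    where
    y<n : _ < n
    y<n = <-trans y<z z<n
    x<n : _ < n
    x<n = <-trans x<y y<n

  T-column : ∀ r → T (toℕ (σ ⟨$⟩ʳ r)) ≡ toℕ r
  T-column r = trans (T-rowOf (toℕ<n _))
    (cong toℕ (trans (cong (σ ⟨$⟩ˡ_) (fromℕ<-toℕ _ _)) (inverseˡ σ)))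

  rowOf-hitsB : ∀ {m t c} (c<n : c < n) → t < m →
                m ∸ suc t ≤ c → c < m → T c + m ≤ n → HitsB m t σ (rowOf c<n)
  rowOf-hitsB {m} {t} c<n t<m lo≤c c<m Tc+m≤n =
    subst₂ (λ i j → InB n m t (suc i) (suc j)) (T-rowOf c<n) (sym (column-rowOf c<n))
      (inB-box t<m Tc+m≤n lo≤c c<m)

theorem4p2 : (n m t : ℕ) → 1 ≤ n → 1 ≤ m → m ≤ n → t ≤ m ∸ 1 →
    (i j : ℕ) → n ∸ t + 1 ≤ i → i ≤ n → m + 1 ≤ j → j ≤ n →
    ¬ (∃[ σ ] (Avoids123 {n} σ ×
         (∃[ r ] (row r ≡ i × col σ r ≡ j)) ×
         IntersectsExactlyOnce m t σ))
theorem4p2 n m t _ 1≤m m≤n t≤m∸1 _ _ n∸t+1≤i _ m+1≤j _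
           (σ , avoids , (r , refl , refl) , (_ , _ , unique)) = two-hits two-columns-in-box
  where
  open InverseOf σ

  t<m : t < m
  t<m = subst (_≤ m) (+-comm t 1) (m≤o∸n⇒m+n≤o t 1≤m t≤m∸1)

  m≤j₀ : m ≤ toℕ (σ ⟨$⟩ʳ r)
  m≤j₀ = s≤s⁻¹ (subst (_≤ suc (toℕ (σ ⟨$⟩ʳ r))) (+-comm m 1) m+1≤j)

  n≤t+i₀ : n ≤ t + toℕ r
  n≤t+i₀ = ≤-trans (m≤n+m∸n n t) (+-monoʳ-≤ t (s≤s⁻¹ 1+n∸t≤1+i₀))
    where
    1+n∸t≤1+i₀ : suc (n ∸ t) ≤ suc (toℕ r)
    1+n∸t≤1+i₀ = subst (_≤ suc (toℕ r)) (+-comm (n ∸ t) 1) n∸t+1≤i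

  open LeftOf T T-< T-injective (T-avoids123 avoids) (T-column r) (toℕ<n _) m≤j₀
  open Window t t<m n≤t+i₀

  two-hits : ∃[ c ] ∃[ c′ ] (c′ < c × InBox c × InBox c′) → ⊥
  two-hits (c , c′ , c′<c , (lo≤c , c<m , box) , (lo≤c′ , c′<m , box′)) =
    <⇒≢ c′<c (rowOf-injective c′<n c<n (trans (unique _ hit′) (sym (unique _ hit))))
    where
    c<n : c < n
    c<n = <-≤-trans c<m m≤n
    c′<n : c′ < n
    c′<n = <-≤-trans c′<m m≤n
    hit : HitsB m t σ (rowOf c<n)
    hit = rowOf-hitsB c<n t<m lo≤c c<m box
    hit′ : HitsB m t σ (rowOf c′<n)
    hit′ = rowOf-hitsB c′<n t<m lo≤c′ c′<m box′
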